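{- Any $\sum\prod\sum\prod$ circuit that computes $\mathrm{Perm}_n$ (or $\mathrm{Det}_n$) such that the fan-in of the multiplication gates at level $3$ is bounded by $v$ must have size $\exp\left[\Omega\left(\frac n v \log n \right)\right]$.
   Context: $\mathrm{Perm}_n=\sum_{\sigma\in\mathfrak S_n}\prod_{i=1}^n x_{i,\sigma(i)}$ and $\mathrm{Det}_n=\sum_{\sigma\in\mathfrak S_n}\mathrm{sgn}(\sigma)\prod_{i=1}^n x_{i,\sigma(i)}$ in the $n^2$ variables $x_{i,j}$. A $\sum\prod\sum\prod$ circuit is a depth-four layered arithmetic circuit: inputs (variables or constants) at level $0$, multiplication gates at levels $1$ and $3$, addition gates at levels $2$ and $4$ (the output at level $4$). Its size is its number of gates. The circuit is not required to be homogeneous. The $\Omega$ constant is absolute. -}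

module Defs where

open import Level using (Level; _⊔_)
open import Data.Nat using (ℕ; zero; suc; _≤_; _<ᵇ_)
import Data.Nat
open import Data.Nat.Properties using () renaming (_≟_ to _≟ℕ_)
import Data.Bool
open import Data.Bool using (Bool; true; false; _∧_; _∨_; not; if_then_else_)
open import Data.Fin using (Fin; toℕ) renaming (_≟_ to _≟F_)
open import Data.Product using (Σ; _×_; _,_; proj₁; proj₂)
open import Data.List using (List; []; _∷_; _++_; map; concatMap; foldr; length; filter; allFin)
open import Data.Bool.ListAction using (and)
open import Data.Vec using (Vec; tabulate; lookup)
import Data.Vec
open import Data.Vec.Properties using (≡-dec)
open import Relation.Nullary using (¬_; Dec; yes; no)
open import Relation.Nullary.Decidable using (⌊_⌋)
open import Relation.Binary.PropositionalEquality using (_≡_)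
open import Algebra.Bundles using (CommutativeRing)

record Field (c ℓ : Level) : Set (Level.suc (c ⊔ ℓ)) where
  field
    commRing : CommutativeRing c ℓ
  open CommutativeRing commRing public
  field
    0≉1     : ¬ (0# ≈ 1#)
    inverse : ∀ x → ¬ (x ≈ 0#) → Σ Carrier (λ y → (x * y) ≈ 1#)

Var : ℕ → Set
Var n = Fin n × Fin n

_=ᵛ_ : ∀ {n} → Var n → Var n → Bool
(i , j) =ᵛ (k , l) = ⌊ i ≟F k ⌋ ∧ ⌊ j ≟F l ⌋

-- a monomial is given by its exponent matrix
Mono : ℕ → Set
Mono n = Vec (Vec ℕ n) n

expOf : ∀ {n} → List (Var n) → Mono n
expOf xs = tabulate λ i → tabulate λ j → length (filter (λ y → ((i , j) =ᵛ y) Data.Bool.≟ true) xs)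

_≟ᴹ_ : ∀ {n} → (a b : Mono n) → Dec (a ≡ b)
_≟ᴹ_ = ≡-dec (≡-dec _≟ℕ_)

-- Formal polynomials over a commutative ring in the n² variables x_{i,j}:
-- a polynomial is a formal sum of terms (coefficient, product of variables);
-- two polynomials are equal iff all their monomial coefficients agree.

module Poly {c ℓ} (R : CommutativeRing c ℓ) (n : ℕ) where
  open CommutativeRing R

  Term : Set c
  Term = Carrier × List (Var n)

  Polynomial : Set c
  Polynomial = List Term

  coeff : Polynomial → Mono n → Carrier
  coeff []             m = 0#
  coeff ((a , xs) ∷ p) m with expOf xs ≟ᴹ m
  ... | yes _ = a + coeff p m
  ... | no  _ = coeff p m

  _≋_ : Polynomial → Polynomial → Set ℓ
  p ≋ q = ∀ m → coeff p m ≈ coeff q m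

  constP : Carrier → Polynomial
  constP a = (a , []) ∷ []

  varP : Var n → Polynomial
  varP x = (1# , x ∷ []) ∷ []

  _⊕_ : Polynomial → Polynomial → Polynomial
  p ⊕ q = p ++ q

  _⊗_ : Polynomial → Polynomial → Polynomial
  p ⊗ q = concatMap (λ s → map (λ t → (proj₁ s * proj₁ t , proj₂ s ++ proj₂ t)) q) p

  sumP : List Polynomial → Polynomial
  sumP = foldr _⊕_ []

  prodP : List Polynomial → Polynomial
  prodP = foldr _⊗_ (constP 1#)

  allVecs : (k : ℕ) → List (Vec (Fin n) k)
  allVecs zero    = Data.Vec.[] ∷ []
  allVecs (suc k) = concatMap (λ i → map (λ v → i Data.Vec.∷ v) (allVecs k)) (allFin n)

  isInjective : Vec (Fin n) n → Bool
  isInjective σ = and (concatMap (λ i → map (λ j →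
      not (lookup σ i =ᶠ lookup σ j) ∨ (i =ᶠ j)) (allFin n)) (allFin n))
    where
    _=ᶠ_ : Fin n → Fin n → Bool
    a =ᶠ b = ⌊ a ≟F b ⌋

  perms : List (Vec (Fin n) n)
  perms = filter (λ σ → isInjective σ Data.Bool.≟ true) (allVecs n)

  inversions : Vec (Fin n) n → ℕ
  inversions σ = length (filter (λ ij → isInv ij Data.Bool.≟ true)
                   (concatMap (λ i → map (λ j → i , j) (allFin n)) (allFin n)))
    where
    isInv : Fin n × Fin n → Bool
    isInv (i , j) = (toℕ i <ᵇ toℕ j) ∧ (toℕ (lookup σ j) <ᵇ toℕ (lookup σ i))

  even : ℕ → Bool
  even zero    = true
  even (suc k) = not (even k)

  sgn : Vec (Fin n) n → Carrier
  sgn σ = if even (inversions σ) then 1# else - 1#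

  monoOf : Vec (Fin n) n → List (Var n)
  monoOf σ = map (λ i → i , lookup σ i) (allFin n)

  Perm : Polynomial
  Perm = map (λ σ → 1# , monoOf σ) perms

  Det : Polynomial
  Det = map (λ σ → sgn σ , monoOf σ) perms

-- Level 0: inputs (variables or constants), not counted as gates.
-- Level 1: k₁ multiplication gates, each reading a list (with repetition,
--          i.e. wires with multiplicity) of inputs.
-- Gates may be shared (it is a circuit, not a formula).

data Input {c} (A : Set c) (n : ℕ) : Set c where
  var   : Var n → Input A n
  const : A → Input A n

record SPSP {c ℓ} (R : CommutativeRing c ℓ) (n : ℕ) : Set c where
  open CommutativeRing R using (Carrier)
  field
    k₁ k₂ k₃ : ℕ
    level1 : Fin k₁ → List (Input Carrier n)
    level2 : Fin k₂ → List (Fin k₁)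
    level3 : Fin k₃ → List (Fin k₂)
    output : List (Fin k₃)

module _ {c ℓ} {R : CommutativeRing c ℓ} {n : ℕ} (C : SPSP R n) where
  open SPSP C
  open Poly R n

  size : ℕ
  size = k₁ N.+ k₂ N.+ k₃ N.+ 1
    where module N = Data.Nat

  Level3FanIn≤ : ℕ → Set
  Level3FanIn≤ v = ∀ g → length (level3 g) ≤ v

  evalInput : Input _ n → Polynomial
  evalInput (var x)   = varP x
  evalInput (const a) = constP a

  eval1 : Fin k₁ → Polynomial
  eval1 g = prodP (map evalInput (level1 g))

  eval2 : Fin k₂ → Polynomial
  eval2 g = sumP (map eval1 (level2 g))

  eval3 : Fin k₃ → Polynomial
  eval3 g = prodP (map eval2 (level3 g))

  value : Polynomial
  value = sumP (map eval3 output)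

  Computes : Polynomial → Set ℓ
  Computes f = value ≋ f

-- Every term of a ΣΠΣΠ circuit is obtained by choosing, in some level-3 gate, one
-- level-1 gate below each of its level-2 inputs and concatenating their variable
-- lists. With k₁ level-1 gates, k₃ level-3 gates and fan-in at most v at level 3,
-- the output therefore involves at most k₃ · k₁^v ≤ s^(v+1) distinct monomials,
-- s the size. Perm_n and Det_n have n! distinct monomials with coefficients ±1,
-- so n! ≤ s^(v+1), and n^n ≤ (n!)² gives n^n ≤ s^(2v+2) ≤ s^(4v).

module Submission where

open import Defs
open import Level using (Level)
open import Data.Nat using (ℕ; _≤_; _*_; _^_)
open import Data.Product using (Σ; _×_)
open import Data.Sum using (_⊎_)

open import Algebra.Bundles using (CommutativeRing)
open import Data.Bool using (Bool; true; false; not; _∨_)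
import Data.Bool
open import Data.Bool.ListAction using (and)
open import Data.Fin using (Fin; zero; suc; punchIn) renaming (_≟_ to _≟F_)
open import Data.Fin.Properties using (punchIn-injective; punchInᵢ≢i)
open import Data.List using (List; []; _∷_; _++_; map; concatMap; filter; length; allFin; cartesianProductWith)
open import Data.List.Properties using (length-++; length-map; length-tabulate)
open import Data.List.Membership.Propositional using (_∈_; find)
open import Data.List.Membership.Propositional.Properties
  using (∈-length; ∈-filter⁺; ∈-filter⁻; ∈-map⁺; ∈-map⁻; ∈-allFin; ∈-concatMap⁺; ∈-concat⁻′;
         ∈-cartesianProductWith⁺; ∈-cartesianProductWith⁻)
open import Data.List.Relation.Binary.Subset.Propositional using (_⊆_)
open import Data.List.Relation.Unary.All as All using (All; []; _∷_)
open import Data.List.Relation.Unary.All.Properties using () renaming (cartesianProductWith⁺ to All-cartesianProductWith⁺)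
open import Data.List.Relation.Unary.Any as Any using (Any; here; there)
open import Data.List.Relation.Unary.Unique.Propositional using (Unique; []; _∷_)
open import Data.List.Relation.Unary.Unique.Propositional.Properties using (allFin⁺; cartesianProductWith⁺; filter⁺; map⁺)
open import Data.Nat using (zero; suc; _+_; _<_; _!; s≤s; z≤n; NonZero; >-nonZero)
open import Data.Nat.Properties
  using (≤-refl; ≤-trans; +-comm; +-suc; +-identityʳ; *-identityʳ; +-mono-≤; +-monoˡ-≤; +-monoʳ-≤;
         *-mono-≤; *-monoˡ-≤; *-monoʳ-≤; *-cancelˡ-≤; m≤m*n; m≤m+n; m≤n+m;
         ^-distribˡ-+-*; ^-monoˡ-≤; ^-monoʳ-≤; module ≤-Reasoning)
open import Data.Nat.Tactic.RingSolver using (solve-∀)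
open import Data.Product using (_,_; proj₁; proj₂; ∃; ∃₂)
open import Data.Sum using (inj₁; inj₂)
open import Data.Vec as Vec using (Vec; lookup)
open import Data.Vec.Properties using (∷-injective; lookup-map; lookup∘tabulate)
open import Data.Vec.Relation.Binary.Pointwise.Extensional using (ext; Pointwise-≡⇒≡)
open import Function using (id; _∘_)
open import Function.Bundles using (_⇔_; mk⇔; Equivalence)
open import Function.Definitions using (Injective)
open import Relation.Nullary using (¬_; Dec; yes; no; contradiction)
open import Relation.Nullary.Decidable using (⌊_⌋)
open import Relation.Binary.PropositionalEquality

private variable
  a b c : Level
  A : Set a
  B : Set b
  C : Set c

[k+r]^k*r!≤k!*[k+r]! : ∀ k r → (k + r) ^ k * r ! ≤ k ! * (k + r) !
[k+r]^k*r!≤k!*[k+r]! zero    r = ≤-refl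
[k+r]^k*r!≤k!*[k+r]! (suc k) r = *-cancelˡ-≤ (suc r) (begin
    suc r * (N ^ suc k * r !)  ≡⟨ reorder₁ N (N ^ k) (suc r) (r !) ⟩
    N * (N ^ k * (suc r) !)    ≤⟨ *-monoʳ-≤ N ih ⟩
    N * (k ! * N !)            ≤⟨ *-monoˡ-≤ (k ! * N !) N≤[1+k]*[1+r] ⟩
    suc k * suc r * (k ! * N !) ≡⟨ reorder₂ (suc k) (suc r) (k !) (N !) ⟩
    suc r * ((suc k) ! * N !)  ∎)
  where
  open ≤-Reasoning
  N : ℕ
  N = suc (k + r)
  ih : N ^ k * (suc r) ! ≤ k ! * N !
  ih = subst (λ m → m ^ k * (suc r) ! ≤ k ! * m !) (+-suc k r) ([k+r]^k*r!≤k!*[k+r]! k (suc r))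
  N≤[1+k]*[1+r] : N ≤ suc k * suc r
  N≤[1+k]*[1+r] = s≤s (subst (_≤ r + k * suc r) (+-comm r k) (+-monoʳ-≤ r (m≤m*n k (suc r))))
  reorder₁ : ∀ a b c d → c * (a * b * d) ≡ a * (b * (c * d))
  reorder₁ = solve-∀
  reorder₂ : ∀ a b c d → a * b * (c * d) ≡ b * (a * c * d)
  reorder₂ = solve-∀

n^n≤n!*n! : ∀ n → n ^ n ≤ n ! * n !
n^n≤n!*n! n = begin
  n ^ n                    ≡⟨ sym (*-identityʳ (n ^ n)) ⟩
  n ^ n * 0 !              ≡⟨ cong (λ m → m ^ n * 1) (sym (+-identityʳ n)) ⟩
  (n + 0) ^ n * 0 !        ≤⟨ [k+r]^k*r!≤k!*[k+r]! n 0 ⟩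
  n ! * (n + 0) !          ≡⟨ cong (λ m → n ! * m !) (+-identityʳ n) ⟩
  n ! * n !                ∎
  where open ≤-Reasoning

[1+v]+[1+v]≤4*v : ∀ {v} → 1 ≤ v → suc v + suc v ≤ 4 * v
[1+v]+[1+v]≤4*v {v} 1≤v = begin
  suc v + suc v      ≤⟨ +-mono-≤ 1+v≤v+v 1+v≤v+v ⟩
  (v + v) + (v + v)  ≡⟨ [v+v]+[v+v]≡4*v v ⟩
  4 * v              ∎
  where
  open ≤-Reasoning
  1+v≤v+v : suc v ≤ v + v
  1+v≤v+v = +-monoˡ-≤ v 1≤v
  [v+v]+[v+v]≡4*v : ∀ v → (v + v) + (v + v) ≡ 4 * v
  [v+v]+[v+v]≡4*v = solve-∀

remove : ∀ {x : A} {ys} → x ∈ ys → List A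
remove {ys = _ ∷ ys} (here _)  = ys
remove {ys = y ∷ _}  (there p) = y ∷ remove p

length-remove : ∀ {x : A} {ys} (p : x ∈ ys) → length ys ≡ suc (length (remove p))
length-remove (here _)  = refl
length-remove (there p) = cong suc (length-remove p)

∈-remove : ∀ {x y : A} {ys} (p : x ∈ ys) → y ∈ ys → x ≢ y → y ∈ remove p
∈-remove (here refl) (here refl) x≢y = contradiction refl x≢y
∈-remove (here _)    (there q)   _   = q
∈-remove (there p)   (here e)    _   = here e
∈-remove (there p)   (there q)   x≢y = there (∈-remove p q x≢y)

Unique∧⊆⇒length≤ : ∀ {xs ys : List A} → Unique xs → xs ⊆ ys → length xs ≤ length ys
Unique∧⊆⇒length≤ {xs = []}          _          _     = z≤n
Unique∧⊆⇒length≤ {xs = x ∷ xs} {ys} (x∉xs ∷ u) xs⊆ys = begin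
  suc (length xs)             ≤⟨ s≤s (Unique∧⊆⇒length≤ u xs⊆remove) ⟩
  suc (length (remove x∈ys))  ≡⟨ length-remove x∈ys ⟨
  length ys                   ∎
  where
  open ≤-Reasoning
  x∈ys : x ∈ ys
  x∈ys = xs⊆ys (here refl)
  xs⊆remove : xs ⊆ remove x∈ys
  xs⊆remove y∈xs = ∈-remove x∈ys (xs⊆ys (there y∈xs)) (All.lookup x∉xs y∈xs)

length-cartesianProductWith : (f : A → B → C) (xs : List A) (ys : List B) →
  length (cartesianProductWith f xs ys) ≡ length xs * length ys
length-cartesianProductWith f []       ys = refl
length-cartesianProductWith f (x ∷ xs) ys = begin
  length (map (f x) ys ++ cartesianProductWith f xs ys)    ≡⟨ length-++ (map (f x) ys) ⟩
  length (map (f x) ys) + length (cartesianProductWith f xs ys)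
    ≡⟨ cong₂ _+_ (length-map (f x) ys) (length-cartesianProductWith f xs ys) ⟩
  length ys + length xs * length ys                        ∎
  where open ≡-Reasoning

concatMap-map≡cartesianProductWith : (f : A → B → C) (xs : List A) (ys : List B) →
  concatMap (λ x → map (f x) ys) xs ≡ cartesianProductWith f xs ys
concatMap-map≡cartesianProductWith f []       ys = refl
concatMap-map≡cartesianProductWith f (x ∷ xs) ys =
  cong (map (f x) ys ++_) (concatMap-map≡cartesianProductWith f xs ys)

length-concatMap≤ : (f : A → List B) {k : ℕ} → (∀ x → length (f x) ≤ k) →
  ∀ xs → length (concatMap f xs) ≤ length xs * k
length-concatMap≤ f bound []       = z≤n
length-concatMap≤ f bound (x ∷ xs) = begin
  length (f x ++ concatMap f xs)          ≡⟨ length-++ (f x) ⟩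
  length (f x) + length (concatMap f xs)  ≤⟨ +-mono-≤ (bound x) (length-concatMap≤ f bound xs) ⟩
  _                                       ∎
  where open ≤-Reasoning

concatenations : List (List A) → ℕ → List (List A)
concatenations ws zero    = [] ∷ []
concatenations ws (suc r) = cartesianProductWith _++_ ws (concatenations ws r)

length-concatenations : (ws : List (List A)) (r : ℕ) → length (concatenations ws r) ≡ length ws ^ r
length-concatenations ws zero    = refl
length-concatenations ws (suc r) =
  trans (length-cartesianProductWith _++_ ws (concatenations ws r))
        (cong (length ws *_) (length-concatenations ws r))

0<length⇒∃∈ : {xs : List A} → 0 < length xs → ∃ (_∈ xs)
0<length⇒∃∈ {xs = x ∷ _} _ = x , here refl

and-true : ∀ {bs} → All (_≡ true) bs → and bs ≡ true
and-true []          = refl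
and-true (refl ∷ ps) = and-true ps

length-allFin : ∀ n → length (allFin n) ≡ n
length-allFin n = length-tabulate id

insert : ∀ {k} → Fin (suc k) → Vec (Fin k) k → Vec (Fin (suc k)) (suc k)
insert i σ = i Vec.∷ Vec.map (punchIn i) σ

allPermutations : (k : ℕ) → List (Vec (Fin k) k)
allPermutations zero    = Vec.[] ∷ []
allPermutations (suc k) = cartesianProductWith insert (allFin (suc k)) (allPermutations k)

length-allPermutations : ∀ k → length (allPermutations k) ≡ k !
length-allPermutations zero    = refl
length-allPermutations (suc k) =
  trans (length-cartesianProductWith insert (allFin (suc k)) (allPermutations k))
        (cong₂ _*_ (length-allFin (suc k)) (length-allPermutations k))

insert-injective : ∀ {k} {i j : Fin (suc k)} {σ τ} → insert i σ ≡ insert j τ → i ≡ j × σ ≡ τ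
insert-injective {i = i} {σ = σ} {τ} eq with ∷-injective eq
... | refl , mapσ≡mapτ = refl , Pointwise-≡⇒≡ (ext λ l → punchIn-injective i _ _ (begin
  punchIn i (lookup σ l)          ≡⟨ lookup-map l (punchIn i) σ ⟨
  lookup (Vec.map (punchIn i) σ) l ≡⟨ cong (λ ρ → lookup ρ l) mapσ≡mapτ ⟩
  lookup (Vec.map (punchIn i) τ) l ≡⟨ lookup-map l (punchIn i) τ ⟩
  punchIn i (lookup τ l)          ∎))
  where open ≡-Reasoning

insert-preserves-injective : ∀ {k} (i : Fin (suc k)) {σ : Vec (Fin k) k} →
  Injective _≡_ _≡_ (lookup σ) → Injective _≡_ _≡_ (lookup (insert i σ))
insert-preserves-injective i {σ} inj {zero}  {zero}  _  = refl
insert-preserves-injective i {σ} inj {zero}  {suc l} eq =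
  contradiction (trans (sym (lookup-map l (punchIn i) σ)) (sym eq)) (punchInᵢ≢i i (lookup σ l))
insert-preserves-injective i {σ} inj {suc l} {zero}  eq =
  contradiction (trans (sym (lookup-map l (punchIn i) σ)) eq) (punchInᵢ≢i i (lookup σ l))
insert-preserves-injective i {σ} inj {suc l} {suc m} eq = cong suc (inj (punchIn-injective i _ _
  (trans (sym (lookup-map l (punchIn i) σ)) (trans eq (lookup-map m (punchIn i) σ)))))

allPermutations-unique : ∀ k → Unique (allPermutations k)
allPermutations-unique zero    = [] ∷ []
allPermutations-unique (suc k) =
  cartesianProductWith⁺ insert insert-injective (allFin⁺ (suc k)) (allPermutations-unique k)

allPermutations-injective : ∀ k {σ} → σ ∈ allPermutations k → Injective _≡_ _≡_ (lookup σ)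
allPermutations-injective zero    (here refl) {()}
allPermutations-injective (suc k) σ∈
  with ∈-cartesianProductWith⁻ insert (allFin (suc k)) (allPermutations k) σ∈
... | i , τ , _ , τ∈ , refl = insert-preserves-injective i (allPermutations-injective k τ∈)

module _ {n : ℕ} where

  exponent : Mono n → Var n → ℕ
  exponent m (i , j) = lookup (lookup m i) j

  =ᵛ-refl : (x : Var n) → (x =ᵛ x) ≡ true
  =ᵛ-refl (i , j) with i ≟F i | j ≟F j
  ... | yes _ | yes _  = refl
  ... | yes _ | no j≢j = contradiction refl j≢j
  ... | no i≢i | _     = contradiction refl i≢i

  =ᵛ⇒≡ : {x y : Var n} → (x =ᵛ y) ≡ true → x ≡ y
  =ᵛ⇒≡ {i , j} {k , l} eq with i ≟F k | j ≟F l
  =ᵛ⇒≡ {i , j} {k , l} refl | yes refl | yes refl = refl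
  =ᵛ⇒≡ {i , j} {k , l} ()   | yes _    | no _
  =ᵛ⇒≡ {i , j} {k , l} ()   | no _     | _

  exponent-expOf : ∀ (xs : List (Var n)) x →
    exponent (expOf xs) x ≡ length (filter (λ y → (x =ᵛ y) Data.Bool.≟ true) xs)
  exponent-expOf xs (i , j) =
    trans (cong (λ row → lookup row j) (lookup∘tabulate _ i)) (lookup∘tabulate _ j)

  ∈⇔0<exponent : ∀ {x} {xs : List (Var n)} → x ∈ xs ⇔ 0 < exponent (expOf xs) x
  ∈⇔0<exponent {x} {xs} = mk⇔
    (λ x∈xs → subst (0 <_) (sym (exponent-expOf xs x)) (∈-length (∈-filter⁺ P? x∈xs (=ᵛ-refl x))))
    (λ 0<e → let _ , y∈ = 0<length⇒∃∈ (subst (0 <_) (exponent-expOf xs x) 0<e)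
                 y∈xs , x=ᵛy = ∈-filter⁻ P? y∈
             in subst (_∈ xs) (sym (=ᵛ⇒≡ x=ᵛy)) y∈xs)
    where
    P? : ∀ y → Dec ((x =ᵛ y) ≡ true)
    P? y = (x =ᵛ y) Data.Bool.≟ true

module PolynomialProperties {c ℓ} (R : CommutativeRing c ℓ) (n : ℕ) where
  open CommutativeRing R
    using (Carrier; _≈_; 0#; 1#; -_; ring; +-congˡ; -‿cong)
    renaming (_*_ to _·_; +-identityʳ to +ᴿ-identityʳ; refl to ≈-refl; sym to ≈-sym; trans to ≈-trans)
  open Poly R n
  open import Algebra.Properties.Ring ring using (-‿involutive; -0#≈0#)

  coeff-≉0⇒occurs : ∀ p m → ¬ coeff p m ≈ 0# → Any (λ t → expOf (proj₂ t) ≡ m) p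
  coeff-≉0⇒occurs []             m ≉0 = contradiction ≈-refl ≉0
  coeff-≉0⇒occurs ((a , xs) ∷ p) m ≉0 with expOf xs ≟ᴹ m
  ... | yes eq = here eq
  ... | no _   = there (coeff-≉0⇒occurs p m ≉0)

  termProduct : Term → Term → Term
  termProduct (a , xs) (b , ys) = a · b , xs ++ ys

  ∈-⊗⁻ : ∀ p q {t} → t ∈ p ⊗ q → ∃₂ λ s u → s ∈ p × u ∈ q × proj₂ t ≡ proj₂ s ++ proj₂ u
  ∈-⊗⁻ p q t∈ with ∈-cartesianProductWith⁻ termProduct p q
                    (subst (_ ∈_) (concatMap-map≡cartesianProductWith termProduct p q) t∈)
  ... | s , u , s∈ , u∈ , refl = s , u , s∈ , u∈ , refl

  ∈-sumP⁻ : ∀ ps {t} → t ∈ sumP ps → ∃ λ p → t ∈ p × p ∈ ps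
  ∈-sumP⁻ ps = ∈-concat⁻′ ps

  ∈-prodP⁻ : ∀ {ws} ps → (∀ {p t} → p ∈ ps → t ∈ p → proj₂ t ∈ ws) →
    ∀ {t} → t ∈ prodP ps → proj₂ t ∈ concatenations ws (length ps)
  ∈-prodP⁻ []       _     (here refl) = here refl
  ∈-prodP⁻ (p ∷ ps) words t∈ with ∈-⊗⁻ p (prodP ps) t∈
  ... | s , u , s∈ , u∈ , eq = subst (_∈ _) (sym eq)
    (∈-cartesianProductWith⁺ _++_ (words (here refl) s∈) (∈-prodP⁻ ps (words ∘ there) u∈))

  module _ {a} {A : Set a} (term : A → Term) where

    coeff-map-≈0 : ∀ L m → (∀ {x} → x ∈ L → expOf (proj₂ (term x)) ≢ m) → coeff (map term L) m ≈ 0#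
    coeff-map-≈0 []      m _   = ≈-refl
    coeff-map-≈0 (x ∷ L) m ≢m with expOf (proj₂ (term x)) ≟ᴹ m
    ... | yes eq = contradiction eq (≢m (here refl))
    ... | no _   = coeff-map-≈0 L m (≢m ∘ there)

    coeff-map : (∀ {x y} → expOf (proj₂ (term x)) ≡ expOf (proj₂ (term y)) → x ≡ y) →
      ∀ {L x} → Unique L → x ∈ L → coeff (map term L) (expOf (proj₂ (term x))) ≈ proj₁ (term x)
    coeff-map inj {y ∷ L} {x} (y∉L ∷ u) x∈ with expOf (proj₂ (term y)) ≟ᴹ expOf (proj₂ (term x))
    coeff-map inj {y ∷ L} {x} (y∉L ∷ u) x∈          | yes eq with inj eq
    ... | refl = ≈-trans (+-congˡ (coeff-map-≈0 L _ λ z∈ eq′ → All.lookup y∉L z∈ (inj (sym eq′))))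
                         (+ᴿ-identityʳ _)
    coeff-map inj {y ∷ L} {x} (y∉L ∷ u) (here refl) | no ≢ = contradiction refl ≢
    coeff-map inj {y ∷ L} {x} (y∉L ∷ u) (there x∈)  | no _ = coeff-map inj u x∈

  monoOf-injective : ∀ {σ τ} → expOf (monoOf σ) ≡ expOf (monoOf τ) → σ ≡ τ
  monoOf-injective {σ} {τ} eq = Pointwise-≡⇒≡ (ext agree)
    where
    -- x_{i,σ(i)} occurs in the monomial of σ, so the equal exponent matrices
    -- force it to occur in that of τ.
    agree : ∀ i → lookup σ i ≡ lookup τ i
    agree i with ∈-map⁻ (λ i → i , lookup τ i) (Equivalence.from (∈⇔0<exponent {xs = monoOf τ})
                   (subst (λ m → 0 < exponent m (i , lookup σ i)) eq
                     (Equivalence.to ∈⇔0<exponent (∈-map⁺ (λ i → i , lookup σ i) (∈-allFin i)))))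
    ... | _ , _ , eq′ = trans (cong proj₂ eq′) (cong (lookup τ) (sym (cong proj₁ eq′)))

  allVecs-suc : ∀ k → allVecs (suc k) ≡ cartesianProductWith Vec._∷_ (allFin n) (allVecs k)
  allVecs-suc k = concatMap-map≡cartesianProductWith Vec._∷_ (allFin n) (allVecs k)

  ∈-allVecs : ∀ k (σ : Vec (Fin n) k) → σ ∈ allVecs k
  ∈-allVecs zero    Vec.[]       = here refl
  ∈-allVecs (suc k) (i Vec.∷ σ) =
    subst (_ ∈_) (sym (allVecs-suc k)) (∈-cartesianProductWith⁺ Vec._∷_ (∈-allFin i) (∈-allVecs k σ))

  allVecs-unique : ∀ k → Unique (allVecs k)
  allVecs-unique zero    = [] ∷ []
  allVecs-unique (suc k) =
    subst Unique (sym (allVecs-suc k)) (cartesianProductWith⁺ Vec._∷_ ∷-injective (allFin⁺ n) (allVecs-unique k))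

  isInjective-true : ∀ σ → Injective _≡_ _≡_ (lookup σ) → isInjective σ ≡ true
  isInjective-true σ inj = and-true (subst (All (_≡ true))
      (sym (concatMap-map≡cartesianProductWith noCollision (allFin n) (allFin n)))
      (All-cartesianProductWith⁺ (setoid (Fin n)) (setoid (Fin n)) noCollision (allFin n) (allFin n)
        λ _ _ → noCollision-true _ _))
    where
    noCollision : Fin n → Fin n → Bool
    noCollision i j = not ⌊ lookup σ i ≟F lookup σ j ⌋ ∨ ⌊ i ≟F j ⌋
    noCollision-true : ∀ i j → noCollision i j ≡ true
    noCollision-true i j with lookup σ i ≟F lookup σ j
    ... | no _   = refl
    ... | yes eq with i ≟F j
    ...   | yes _  = refl
    ...   | no i≢j = contradiction (inj eq) i≢j

  perms-unique : Unique perms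
  perms-unique = filter⁺ _ (allVecs-unique n)

  ∈-perms : ∀ σ → Injective _≡_ _≡_ (lookup σ) → σ ∈ perms
  ∈-perms σ inj = ∈-filter⁺ _ (∈-allVecs n σ) (isInjective-true σ inj)

  coeff-Perm : ∀ σ → Injective _≡_ _≡_ (lookup σ) → coeff Perm (expOf (monoOf σ)) ≈ 1#
  coeff-Perm σ inj = coeff-map (λ τ → 1# , monoOf τ) monoOf-injective perms-unique (∈-perms σ inj)

  coeff-Det : ∀ σ → Injective _≡_ _≡_ (lookup σ) → coeff Det (expOf (monoOf σ)) ≈ sgn σ
  coeff-Det σ inj = coeff-map (λ τ → sgn τ , monoOf τ) monoOf-injective perms-unique (∈-perms σ inj)

  sgn-≉0 : ¬ 1# ≈ 0# → ∀ σ → ¬ sgn σ ≈ 0#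
  sgn-≉0 1≉0 σ with even (inversions σ)
  ... | true  = 1≉0
  ... | false = λ -1≈0 → 1≉0 (≈-trans (≈-sym (-‿involutive 1#)) (≈-trans (-‿cong -1≈0) (-0#≈0#)))

  permutationMonomials : List (Mono n)
  permutationMonomials = map (expOf ∘ monoOf) (allPermutations n)

  permutationMonomials-unique : Unique permutationMonomials
  permutationMonomials-unique = map⁺ monoOf-injective (allPermutations-unique n)

  length-permutationMonomials : length permutationMonomials ≡ n !
  length-permutationMonomials = trans (length-map (expOf ∘ monoOf) (allPermutations n)) (length-allPermutations n)

  ≉0-resp-≈ : ∀ {a b} → a ≈ b → ¬ b ≈ 0# → ¬ a ≈ 0#
  ≉0-resp-≈ a≈b b≉0 a≈0 = b≉0 (≈-trans (≈-sym a≈b) a≈0)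

  coeff-Perm-≉0 : ¬ 1# ≈ 0# → ∀ {m} → m ∈ permutationMonomials → ¬ coeff Perm m ≈ 0#
  coeff-Perm-≉0 1≉0 m∈ with ∈-map⁻ (expOf ∘ monoOf) m∈
  ... | σ , σ∈ , refl = ≉0-resp-≈ (coeff-Perm σ (allPermutations-injective n σ∈)) 1≉0

  coeff-Det-≉0 : ¬ 1# ≈ 0# → ∀ {m} → m ∈ permutationMonomials → ¬ coeff Det m ≈ 0#
  coeff-Det-≉0 1≉0 m∈ with ∈-map⁻ (expOf ∘ monoOf) m∈
  ... | σ , σ∈ , refl = ≉0-resp-≈ (coeff-Det σ (allPermutations-injective n σ∈)) (sgn-≉0 1≉0 σ)

module CircuitProperties {c ℓ} {R : CommutativeRing c ℓ} {n : ℕ} (C : SPSP R n) where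
  open SPSP C
  open CommutativeRing R using (Carrier; _≈_; 0#) renaming (sym to ≈-sym; trans to ≈-trans)
  open Poly R n
  open PolynomialProperties R n

  inputVars : List (Input Carrier n) → List (Var n)
  inputVars []            = []
  inputVars (var x ∷ is)   = x ∷ inputVars is
  inputVars (const _ ∷ is) = inputVars is

  ∈-prod-inputs⁻ : ∀ is {t} → t ∈ prodP (map (evalInput C) is) → proj₂ t ≡ inputVars is
  ∈-prod-inputs⁻ []       (here refl) = refl
  ∈-prod-inputs⁻ (i ∷ is) t∈ with i | ∈-⊗⁻ (evalInput C i) (prodP (map (evalInput C) is)) t∈
  ... | var x   | _ , _ , here refl , u∈ , eq = trans eq (cong (x ∷_) (∈-prod-inputs⁻ is u∈))
  ... | const _ | _ , _ , here refl , u∈ , eq = trans eq (∈-prod-inputs⁻ is u∈)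

  level1Monomials : List (List (Var n))
  level1Monomials = map (inputVars ∘ level1) (allFin k₁)

  length-level1Monomials : length level1Monomials ≡ k₁
  length-level1Monomials = trans (length-map (inputVars ∘ level1) (allFin k₁)) (length-allFin k₁)

  ∈-eval2⁻ : ∀ g {t} → t ∈ eval2 C g → proj₂ t ∈ level1Monomials
  ∈-eval2⁻ g t∈ with ∈-sumP⁻ (map (eval1 C) (level2 g)) t∈
  ... | p , t∈p , p∈ with ∈-map⁻ (eval1 C) p∈
  ... | h , _ , refl = subst (_∈ level1Monomials) (sym (∈-prod-inputs⁻ (level1 h) t∈p))
                         (∈-map⁺ (inputVars ∘ level1) (∈-allFin h))

  gateMonomials : Fin k₃ → List (List (Var n))
  gateMonomials g = concatenations level1Monomials (length (level3 g))

  ∈-eval3⁻ : ∀ g {t} → t ∈ eval3 C g → proj₂ t ∈ gateMonomials g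
  ∈-eval3⁻ g t∈ = subst (λ r → _ ∈ concatenations level1Monomials r) (length-map (eval2 C) (level3 g))
    (∈-prodP⁻ (map (eval2 C) (level3 g)) factorMonomials t∈)
    where
    factorMonomials : ∀ {p t} → p ∈ map (eval2 C) (level3 g) → t ∈ p → proj₂ t ∈ level1Monomials
    factorMonomials p∈ t∈p with ∈-map⁻ (eval2 C) p∈
    ... | g′ , _ , refl = ∈-eval2⁻ g′ t∈p

  candidates : List (List (Var n))
  candidates = concatMap gateMonomials (allFin k₃)

  ∈-value⁻ : ∀ {t} → t ∈ value C → proj₂ t ∈ candidates
  ∈-value⁻ t∈ with ∈-sumP⁻ (map (eval3 C) output) t∈
  ... | p , t∈p , p∈ with ∈-map⁻ (eval3 C) p∈
  ... | g , _ , refl = ∈-concatMap⁺ gateMonomials (Any.map (λ { refl → ∈-eval3⁻ g t∈p }) (∈-allFin g))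

  k₁≤size : k₁ ≤ size C
  k₁≤size = ≤-trans (m≤m+n k₁ k₂) (≤-trans (m≤m+n (k₁ + k₂) k₃) (m≤m+n (k₁ + k₂ + k₃) 1))

  k₃≤size : k₃ ≤ size C
  k₃≤size = ≤-trans (m≤n+m k₃ (k₁ + k₂)) (m≤m+n (k₁ + k₂ + k₃) 1)

  instance
    size-nonZero : NonZero (size C)
    size-nonZero = >-nonZero (m≤n+m 1 (k₁ + k₂ + k₃))

  length-candidates≤ : ∀ {v} → Level3FanIn≤ C v → length candidates ≤ size C ^ suc v
  length-candidates≤ {v} fanIn = begin
    length candidates                ≤⟨ length-concatMap≤ gateMonomials length-gateMonomials≤ (allFin k₃) ⟩
    length (allFin k₃) * size C ^ v  ≡⟨ cong (_* size C ^ v) (length-allFin k₃) ⟩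
    k₃ * size C ^ v                  ≤⟨ *-mono-≤ k₃≤size (≤-refl {size C ^ v}) ⟩
    size C ^ suc v                   ∎
    where
    open ≤-Reasoning
    length-gateMonomials≤ : ∀ g → length (gateMonomials g) ≤ size C ^ v
    length-gateMonomials≤ g = begin
      length (gateMonomials g)                   ≡⟨ length-concatenations level1Monomials (length (level3 g)) ⟩
      length level1Monomials ^ length (level3 g) ≡⟨ cong (_^ length (level3 g)) length-level1Monomials ⟩
      k₁ ^ length (level3 g)                     ≤⟨ ^-monoˡ-≤ (length (level3 g)) k₁≤size ⟩
      size C ^ length (level3 g)                 ≤⟨ ^-monoʳ-≤ (size C) (fanIn g) ⟩
      size C ^ v                                 ∎

  monomialCount≤size^[1+v] : ∀ {v f} → Level3FanIn≤ C v → Computes C f →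
    ∀ {ms} → Unique ms → (∀ {m} → m ∈ ms → ¬ coeff f m ≈ 0#) → length ms ≤ size C ^ suc v
  monomialCount≤size^[1+v] {v} {f} fanIn computes {ms} unique nonzero = begin
    length ms                      ≤⟨ Unique∧⊆⇒length≤ unique ms⊆ ⟩
    length (map expOf candidates)  ≡⟨ length-map expOf candidates ⟩
    length candidates              ≤⟨ length-candidates≤ fanIn ⟩
    size C ^ suc v                 ∎
    where
    open ≤-Reasoning
    ms⊆ : ms ⊆ map expOf candidates
    ms⊆ {m} m∈ with find (coeff-≉0⇒occurs (value C) m λ ≈0 → nonzero m∈ (≈-trans (≈-sym (computes m)) ≈0))
    ... | t , t∈ , refl = ∈-map⁺ expOf (∈-value⁻ t∈)

module _ {c ℓ} {R : CommutativeRing c ℓ} where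
  open CommutativeRing R using (_≈_; 0#; 1#)

  n!≤size^[1+v] : ∀ {n v} → ¬ 1# ≈ 0# → (C : SPSP R n) → Level3FanIn≤ C v →
    Computes C (Poly.Perm R n) ⊎ Computes C (Poly.Det R n) → n ! ≤ size C ^ suc v
  n!≤size^[1+v] {n} {v} 1≉0 C fanIn computes = subst (_≤ _) length-permutationMonomials (bound computes)
    where
    open Poly R n using (Perm; Det)
    open PolynomialProperties R n
    open CircuitProperties C
    bound : Computes C Perm ⊎ Computes C Det → length permutationMonomials ≤ size C ^ suc v
    bound (inj₁ computesPerm) =
      monomialCount≤size^[1+v] {f = Perm} fanIn computesPerm permutationMonomials-unique (coeff-Perm-≉0 1≉0)
    bound (inj₂ computesDet)  =
      monomialCount≤size^[1+v] {f = Det} fanIn computesDet permutationMonomials-unique (coeff-Det-≉0 1≉0)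

  n^n≤size^[4*v] : ∀ {n v} → ¬ 1# ≈ 0# → 1 ≤ v → (C : SPSP R n) → Level3FanIn≤ C v →
    Computes C (Poly.Perm R n) ⊎ Computes C (Poly.Det R n) → n ^ n ≤ size C ^ (4 * v)
  n^n≤size^[4*v] {n} {v} 1≉0 1≤v C fanIn computes = begin
    n ^ n                             ≤⟨ n^n≤n!*n! n ⟩
    n ! * n !                         ≤⟨ *-mono-≤ n!≤s^[1+v] n!≤s^[1+v] ⟩
    size C ^ suc v * size C ^ suc v   ≡⟨ ^-distribˡ-+-* (size C) (suc v) (suc v) ⟨
    size C ^ (suc v + suc v)          ≤⟨ ^-monoʳ-≤ (size C) ([1+v]+[1+v]≤4*v 1≤v) ⟩
    size C ^ (4 * v)                  ∎
    where
    open ≤-Reasoning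
    open CircuitProperties C using (size-nonZero)
    n!≤s^[1+v] : n ! ≤ size C ^ suc v
    n!≤s^[1+v] = n!≤size^[1+v] 1≉0 C fanIn computes

lemma6 : ∀ {c ℓ : Level} →
    Σ ℕ λ p → Σ ℕ λ q → Σ ℕ λ n₀ → 1 ≤ p × 1 ≤ q ×
      ((F : Field c ℓ) (n v : ℕ) → n₀ ≤ n → 1 ≤ v →
       (C : SPSP (Field.commRing F) n) → Level3FanIn≤ C v →
       (Computes C (Poly.Perm (Field.commRing F) n) ⊎ Computes C (Poly.Det (Field.commRing F) n)) →
       n ^ (p * n) ≤ size C ^ (q * v))
lemma6 = 1 , 4 , 0 , s≤s z≤n , s≤s z≤n , λ F n v _ 1≤v C fanIn computes →
  subst (λ e → n ^ e ≤ size C ^ (4 * v)) (sym (+-identityʳ n))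
    (n^n≤size^[4*v] (λ 1≈0 → Field.0≉1 F (Field.sym F 1≈0)) 1≤v C fanIn computes)
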